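{- Let $G$ be a simple bipartite super edge-magic graph with stable sets $X=\{x_i\}_{i=1}^s$ and $Y=\{y_j\}_{j=1}^t$, and suppose $G\cong H_1\oplus H_2$ is a decomposition of $G$. Then $\lim_{n\to\infty}|\sigma_{S_{2n}(G;H_1,H_2)}|=\infty$.
   Context: A decomposition $G\cong H_1\oplus H_2$ means $H_1,H_2$ are subgraphs of $G$ whose edge sets partition $E(G)$. A super edge-magic labeling of a graph with $p$ vertices and $q$ edges is a bijection $f:V\cup E\to[1,p+q]$ with $f(V)=[1,p]$ such that $f(x)+f(xy)+f(y)$ is a constant (the valence) over all edges $xy$; here $[a,b]=\{a,\dots,b\}$. Let $S_G=\{(\sum_{u\in V}\deg(u)g(u)+\sum_{i=p+1}^{p+q}i)/q: g:V\to[1,p]\text{ bijective}\}$, $I_G=[\lceil\min S_G\rceil,\lfloor\max S_G\rfloor]$ and $\sigma_G=\{k\in I_G: k\text{ is the valence of some super edge-magic labeling of }G\}$. $S_{2n}(G;H_1,H_2)$ is the graph with vertex set $X\cup Y\cup\bigcup_{k=1}^n X_k\cup\bigcup_{k=1}^n Y_k$, where $X_k=\{x_i^k\}_{i=1}^s$, $Y_k=\{y_j^k\}_{j=1}^t$ are new vertices, and edge set $E(G)\cup\{x_iy_j^k: x_iy_j\in E(H_1),\,k\in[1,n]\}\cup\{x_i^ky_j: x_iy_j\in E(H_2),\,k\in[1,n]\}$. -}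

module Defs where

open import Data.Nat using (ℕ; zero; suc; _+_; _*_; _≤_)
open import Data.Fin using (Fin; toℕ; _↑ˡ_; _↑ʳ_; combine; _≟_)
open import Data.Bool using (Bool; true; false; if_then_else_)
open import Data.Product using (Σ; ∃; _×_; _,_; proj₁; proj₂)
open import Data.List using (List; map; allFin; upTo; length; filter)
open import Data.Nat.ListAction using (sum)
open import Data.Sum using (_⊎_)
open import Function.Bundles using (_⤖_; Bijection)
open import Function.Definitions using (Injective)
open import Relation.Binary.PropositionalEquality using (_≡_)
open import Relation.Nullary.Decidable using (_⊎-dec_)

record Graph : Set where
  field
    p   : ℕ
    q   : ℕ
    src : Fin q → Fin p
    tgt : Fin q → Fin p

open Graph public

-- The labeling f restricted to V, given by a bijection V → [1,p].
vlabel : {p : ℕ} → Fin p ⤖ Fin p → Fin p → ℕ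
vlabel g v = suc (toℕ (Bijection.to g v))

-- The labeling f restricted to E, given by a bijection E → [p+1,p+q].
elabel : (p : ℕ) {q : ℕ} → Fin q ⤖ Fin q → Fin q → ℕ
elabel p h e = p + suc (toℕ (Bijection.to h e))

-- A super edge-magic labeling of Γ with valence k: a bijection
-- f : V ∪ E → [1,p+q] with f(V) = [1,p] (hence f(E) = [p+1,p+q])
-- such that f(x) + f(xy) + f(y) = k for every edge xy.
record SEM (Γ : Graph) (k : ℕ) : Set where
  field
    fV    : Fin (p Γ) ⤖ Fin (p Γ)
    fE    : Fin (q Γ) ⤖ Fin (q Γ)
    magic : ∀ e → vlabel fV (src Γ e) + elabel (p Γ) fE e + vlabel fV (tgt Γ e) ≡ k

SuperEdgeMagic : Graph → Set
SuperEdgeMagic Γ = ∃ λ k → SEM Γ k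

deg : (Γ : Graph) → Fin (p Γ) → ℕ
deg Γ u = length (filter (λ e → (src Γ e ≟ u) ⊎-dec (tgt Γ e ≟ u)) (allFin (q Γ)))

edgeLabelSum : ℕ → ℕ → ℕ
edgeLabelSum p q = sum (map (λ i → p + suc i) (upTo q))

-- numerator of the element of S_Γ determined by the bijection g : V → [1,p]:
-- Σ_u deg(u) g(u) + Σ_{i=p+1}^{p+q} i   (the element of S_Γ is this / q)
Snum : (Γ : Graph) → Fin (p Γ) ⤖ Fin (p Γ) → ℕ
Snum Γ g = sum (map (λ u → deg Γ u * vlabel g u) (allFin (p Γ))) + edgeLabelSum (p Γ) (q Γ)

-- k ∈ I_Γ = [⌈min S_Γ⌉, ⌊max S_Γ⌋]; for an integer k this is
-- min S_Γ ≤ k ≤ max S_Γ, i.e. some element of S_Γ is ≤ k and some is ≥ k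
-- (elements written as Snum/q, cleared of the denominator q).
InI : Graph → ℕ → Set
InI Γ k = (∃ λ g → Snum Γ g ≤ q Γ * k) × (∃ λ g → q Γ * k ≤ Snum Γ g)

Inσ : Graph → ℕ → Set
Inσ Γ k = InI Γ k × SEM Γ k

-- |A| ≥ M for a set A ⊆ ℕ given as a predicate: A has M distinct elements.
CardGE : ℕ → (ℕ → Set) → Set
CardGE M A = Σ (Fin M → ℕ) λ ks → Injective _≡_ _≡_ ks × (∀ i → A (ks i))

-- Bipartite graph with stable sets X = {x_i}_{i<s}, Y = {y_j}_{j<t}
-- and q edges given by an (injective) map edge : Fin q → X × Y.
-- Vertex encoding: x_i ↦ i ↑ˡ t, y_j ↦ s ↑ʳ j.

bipartite : (s t q : ℕ) → (Fin q → Fin s × Fin t) → Graph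
bipartite s t q edge = record
  { p = s + t
  ; q = q
  ; src = λ e → proj₁ (edge e) ↑ˡ t
  ; tgt = λ e → s ↑ʳ proj₂ (edge e)
  }

-- S_{2n}(G;H1,H2), where the decomposition G ≅ H1 ⊕ H2 is given by
-- inH1 : Fin q → Bool (edge e is in H1 iff inH1 e ≡ true, else in H2).
-- Vertices: X, Y, X_1..X_n, Y_1..Y_n encoded in Fin ((s + t) + (n*s + n*t)).
-- Edges: E(G) (Fin q), plus for each k and each edge e = x_i y_j of G one
-- new edge: x_i y_j^k if e ∈ H1, x_i^k y_j if e ∈ H2.
S2n : (s t q : ℕ) → (Fin q → Fin s × Fin t) → (Fin q → Bool) → ℕ → Graph
S2n s t q edge inH1 n = record
  { p = (s + t) + (n * s + n * t)
  ; q = q + n * q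
  ; src = srcE
  ; tgt = tgtE
  }
  where
    P = (s + t) + (n * s + n * t)
    x : Fin s → Fin P
    x i = (i ↑ˡ t) ↑ˡ (n * s + n * t)
    y : Fin t → Fin P
    y j = (s ↑ʳ j) ↑ˡ (n * s + n * t)
    xk : Fin n → Fin s → Fin P
    xk k i = (s + t) ↑ʳ (combine k i ↑ˡ (n * t))
    yk : Fin n → Fin t → Fin P
    yk k j = (s + t) ↑ʳ ((n * s) ↑ʳ combine k j)
    srcNew : Fin n → Fin q → Fin P
    srcNew k e = if inH1 e then x (proj₁ (edge e)) else xk k (proj₁ (edge e))
    tgtNew : Fin n → Fin q → Fin P
    tgtNew k e = if inH1 e then yk k (proj₂ (edge e)) else y (proj₂ (edge e))
    srcE : Fin (q + n * q) → Fin P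
    srcE e with Data.Fin.splitAt q e
    ... | Data.Sum.inj₁ e₀ = x (proj₁ (edge e₀))
    ... | Data.Sum.inj₂ ke with Data.Fin.remQuot q ke
    ...   | (k , e₀) = srcNew k e₀
    tgtE : Fin (q + n * q) → Fin P
    tgtE e with Data.Fin.splitAt q e
    ... | Data.Sum.inj₁ e₀ = y (proj₂ (edge e₀))
    ... | Data.Sum.inj₂ ke with Data.Fin.remQuot q ke
    ...   | (k , e₀) = tgtNew k e₀

module Submission where

-- Idea (following the paper): S_{2n}(G;H1,H2) is made of n+1 copies of G —
-- copy 0 is G itself and copy k+1 consists of the vertices X_{k+1} ∪ Y_{k+1}
-- together with one edge over each edge of G joining copy 0 to copy k+1.
-- Given a super edge-magic labeling f of G, label the copy c of a vertex x by
-- (n+1)·f(x) + α(c) and the copy c of an edge e by (n+1)·f(e) + β(c), where α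
-- swaps copies 0 and r and β = n − α. Because every edge joins copy 0 to its
-- own copy, the offsets along each edge add up to n + r, so this is a super
-- edge-magic labeling whose valence grows with r: S_{2n} has n+1 distinct
-- valences. A double-counting argument shows that every valence of a
-- loopless graph lies in I_Γ, so all of them belong to σ_{S_{2n}}.

open import Defs
open import Data.Nat using (ℕ; zero; suc; _+_; _*_; _∸_; _≤_)
open import Data.Nat.Properties
  using (+-0-commutativeMonoid; +-identityʳ; *-zeroʳ; +-comm; +-assoc; *-distribʳ-+; ≤-reflexive; <-irrefl; m+n∸n≡m; m+[n∸m]≡n; *-suc; *-comm; *-distribˡ-+; +-cancelˡ-≡; m≤n⇒m≤1+n)
open import Data.Nat.Solver using (module +-*-Solver)
open import Data.Fin using (Fin; toℕ; _≟_; _↑ˡ_; _↑ʳ_; splitAt; punchOut; cast; combine; remQuot; quotRem; inject≤) renaming (zero to fzero; suc to fsuc)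
open import Data.Fin.Properties using (splitAt-↑ˡ; splitAt-↑ʳ; any?; injective⇒≤; punchOut-injective; toℕ-cast; toℕ-combine; combine-injective; toℕ-injective; opposite-prop; toℕ≤pred[n]; splitAt⁻¹-↑ˡ; splitAt⁻¹-↑ʳ; combine-remQuot; remQuot-combine; inject≤-injective)
open import Data.Bool using (Bool; true; false; if_then_else_)
open import Data.Product using (∃; _×_; _,_; proj₁; proj₂)
open import Data.Sum using (_⊎_; inj₁; inj₂; [_,_]′)
open import Data.Fin.Permutation using (transpose; reverse; _∘ₚ_; _⟨$⟩ʳ_)
open import Data.List using (map; allFin; length; filter; tabulate; applyUpTo)
open import Data.List.Properties using (map-tabulate; map-upTo)
open import Data.Nat.ListAction using (sum)
open import Data.Empty using (⊥-elim)
open import Function.Bundles using (_⤖_; Bijection; mk⤖)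
open import Function.Definitions using (Injective)
open import Function.Properties.Bijection using (⤖⇒↔)
open import Function.Properties.Inverse using (↔⇒⤖)
open import Function.Consequences.Propositional using (inverseʳ⇒injective; strictlyInverseʳ⇒inverseʳ)
open import Relation.Binary.PropositionalEquality
open import Relation.Nullary using (Dec; does; yes; no; ¬_)
open import Relation.Nullary.Decidable using (_⊎-dec_)
open import Relation.Unary using (Pred; Decidable)
import Algebra.Properties.CommutativeMonoid.Sum as CommutativeMonoidSum

open CommutativeMonoidSum +-0-commutativeMonoid
  using (sum-syntax; sum-cong-≗; ∑-distrib-+; ∑-comm; ∑-permute)
  renaming (sum to ∑)

χ : ∀ {ℓ} {P : Set ℓ} → Dec P → ℕ
χ d = if does d then 1 else 0

sum-tabulate : ∀ {n} (f : Fin n → ℕ) → sum (tabulate f) ≡ ∑ f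
sum-tabulate {zero}  f = refl
sum-tabulate {suc n} f = cong (f fzero +_) (sum-tabulate (λ i → f (fsuc i)))

sum-allFin : ∀ {n} (f : Fin n → ℕ) → sum (map f (allFin n)) ≡ ∑ f
sum-allFin f = trans (cong sum (map-tabulate (λ i → i) f)) (sum-tabulate f)

sum-applyUpTo : ∀ n (f : ℕ → ℕ) → sum (applyUpTo f n) ≡ ∑[ i < n ] f (toℕ i)
sum-applyUpTo zero    f = refl
sum-applyUpTo (suc n) f = cong (f 0 +_) (sum-applyUpTo n (λ i → f (suc i)))

length-filter-tabulate : ∀ {a ℓ} {A : Set a} {P : Pred A ℓ} (P? : Decidable P) {n} (g : Fin n → A) →
  length (filter P? (tabulate g)) ≡ ∑[ i < n ] χ (P? (g i))
length-filter-tabulate P? {zero}  g = refl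
length-filter-tabulate P? {suc n} g with does (P? (g fzero))
... | true  = cong suc (length-filter-tabulate P? (λ i → g (fsuc i)))
... | false = length-filter-tabulate P? (λ i → g (fsuc i))

∑-*ʳ : ∀ {n} (f : Fin n → ℕ) c → ∑ f * c ≡ ∑[ i < n ] (f i * c)
∑-*ʳ {zero}  f c = refl
∑-*ʳ {suc n} f c = trans (*-distribʳ-+ c (f fzero) _) (cong (f fzero * c +_) (∑-*ʳ (λ i → f (fsuc i)) c))

∑-const : ∀ n c → ∑[ i < n ] c ≡ n * c
∑-const zero    c = refl
∑-const (suc n) c = cong (c +_) (∑-const n c)

∑-pick : ∀ {n} (a : Fin n) (w : Fin n → ℕ) → ∑[ u < n ] (χ (a ≟ u) * w u) ≡ w a
∑-pick {suc n} fzero    w = trans (cong₂ _+_ (+-identityʳ (w fzero)) (∑-zero n)) (+-identityʳ (w fzero))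
  where
  ∑-zero : ∀ m → ∑[ i < m ] 0 ≡ 0
  ∑-zero m = trans (∑-const m 0) (*-zeroʳ m)
∑-pick {suc n} (fsuc a) w = ∑-pick a (λ u → w (fsuc u))

Loopless : Graph → Set
Loopless Γ = ∀ e → ¬ (src Γ e ≡ tgt Γ e)

χ-⊎-disjoint : ∀ {ℓ} {P Q : Set ℓ} (p? : Dec P) (q? : Dec Q) → ¬ (P × Q) → χ (p? ⊎-dec q?) ≡ χ p? + χ q?
χ-⊎-disjoint (yes p) (yes q) incompatible = ⊥-elim (incompatible (p , q))
χ-⊎-disjoint (yes p) (no ¬q) incompatible = refl
χ-⊎-disjoint (no ¬p) (yes q) incompatible = refl
χ-⊎-disjoint (no ¬p) (no ¬q) incompatible = refl

deg-as-sum : (Γ : Graph) → Loopless Γ → ∀ u →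
  deg Γ u ≡ ∑[ e < q Γ ] (χ (src Γ e ≟ u) + χ (tgt Γ e ≟ u))
deg-as-sum Γ loopless u =
  trans (length-filter-tabulate (λ e → (src Γ e ≟ u) ⊎-dec (tgt Γ e ≟ u)) (λ e → e))
        (sum-cong-≗ (λ e → χ-⊎-disjoint (src Γ e ≟ u) (tgt Γ e ≟ u)
                             (λ { (refl , tgt≡u) → loopless e (sym tgt≡u) })))

weighted-handshake : (Γ : Graph) → Loopless Γ → (w : Fin (p Γ) → ℕ) →
  ∑[ u < p Γ ] (deg Γ u * w u) ≡ ∑[ e < q Γ ] (w (src Γ e) + w (tgt Γ e))
weighted-handshake Γ loopless w = begin
  ∑[ u < p Γ ] (deg Γ u * w u)
    ≡⟨ sum-cong-≗ {p Γ} (λ u → trans (cong (_* w u) (deg-as-sum Γ loopless u)) (∑-*ʳ {q Γ} _ (w u))) ⟩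
  ∑[ u < p Γ ] ∑[ e < q Γ ] (ends e u * w u)
    ≡⟨ ∑-comm (λ u e → ends e u * w u) ⟩
  ∑[ e < q Γ ] ∑[ u < p Γ ] (ends e u * w u)
    ≡⟨ sum-cong-≗ endpoint-sum ⟩
  ∑[ e < q Γ ] (w (src Γ e) + w (tgt Γ e)) ∎
  where
  open ≡-Reasoning
  ends : Fin (q Γ) → Fin (p Γ) → ℕ
  ends e u = χ (src Γ e ≟ u) + χ (tgt Γ e ≟ u)
  endpoint-sum : ∀ e → ∑[ u < p Γ ] (ends e u * w u) ≡ w (src Γ e) + w (tgt Γ e)
  endpoint-sum e = begin
    ∑[ u < p Γ ] (ends e u * w u)
      ≡⟨ sum-cong-≗ {p Γ} (λ u → *-distribʳ-+ (w u) (χ (src Γ e ≟ u)) _) ⟩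
    ∑[ u < p Γ ] (χ (src Γ e ≟ u) * w u + χ (tgt Γ e ≟ u) * w u)
      ≡⟨ ∑-distrib-+ {p Γ} _ _ ⟩
    ∑[ u < p Γ ] (χ (src Γ e ≟ u) * w u) + ∑[ u < p Γ ] (χ (tgt Γ e ≟ u) * w u)
      ≡⟨ cong₂ _+_ (∑-pick (src Γ e) w) (∑-pick (tgt Γ e) w) ⟩
    w (src Γ e) + w (tgt Γ e) ∎

Snum-valence : (Γ : Graph) → Loopless Γ → ∀ {k} (L : SEM Γ k) → Snum Γ (SEM.fV L) ≡ q Γ * k
Snum-valence Γ loopless {k} L = begin
  sum (map (λ u → deg Γ u * w u) (allFin (p Γ))) + edgeLabelSum (p Γ) (q Γ)
    ≡⟨ cong₂ _+_ (sum-allFin (λ u → deg Γ u * w u))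
                 (trans (cong sum (map-upTo _ (q Γ))) (sum-applyUpTo (q Γ) (λ i → p Γ + suc i))) ⟩
  ∑[ u < p Γ ] (deg Γ u * w u) + ∑[ i < q Γ ] (p Γ + suc (toℕ i))
    ≡⟨ cong₂ _+_ (weighted-handshake Γ loopless w)
                 (∑-permute (λ i → p Γ + suc (toℕ i)) (⤖⇒↔ (SEM.fE L))) ⟩
  ∑[ e < q Γ ] (w (src Γ e) + w (tgt Γ e)) + ∑[ e < q Γ ] ℓ e
    ≡⟨ ∑-distrib-+ _ ℓ ⟨
  ∑[ e < q Γ ] (w (src Γ e) + w (tgt Γ e) + ℓ e)
    ≡⟨ sum-cong-≗ edge-valence ⟩
  ∑[ e < q Γ ] k
    ≡⟨ ∑-const (q Γ) k ⟩
  q Γ * k ∎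
  where
  open ≡-Reasoning
  w = vlabel (SEM.fV L)
  ℓ = elabel (p Γ) (SEM.fE L)
  edge-valence : ∀ e → w (src Γ e) + w (tgt Γ e) + ℓ e ≡ k
  edge-valence e = trans (+-assoc (w (src Γ e)) _ _)
    (trans (cong (w (src Γ e) +_) (+-comm (w (tgt Γ e)) (ℓ e)))
      (trans (sym (+-assoc (w (src Γ e)) _ _)) (SEM.magic L e)))

SEM⇒Inσ : (Γ : Graph) → Loopless Γ → ∀ {k} → SEM Γ k → Inσ Γ k
SEM⇒Inσ Γ loopless L =
  ((SEM.fV L , ≤-reflexive Snum≡) , (SEM.fV L , ≤-reflexive (sym Snum≡))) , L
  where Snum≡ = Snum-valence Γ loopless L

bipartite-loopless : ∀ s t q edge → Loopless (bipartite s t q edge)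
bipartite-loopless s t q edge e x≡y
  with trans (sym (splitAt-↑ˡ s (proj₁ (edge e)) t))
             (trans (cong (splitAt s) x≡y) (splitAt-↑ʳ s t (proj₂ (edge e))))
... | ()

-- Finite pigeonhole: an injective endomap of Fin n misses no value y,
-- since otherwise punchOut would inject Fin (suc m) into Fin m.
injective-endo-hits : ∀ {n} (f : Fin n → Fin n) → Injective _≡_ _≡_ f →
  (y : Fin n) → ¬ (∀ x → ¬ (y ≡ f x))
injective-endo-hits {suc m} f f-inj y y≢f = <-irrefl refl (injective⇒≤ squeeze-inj)
  where
  squeeze : Fin (suc m) → Fin m
  squeeze x = punchOut (y≢f x)
  squeeze-inj : Injective _≡_ _≡_ squeeze
  squeeze-inj {a} {b} eq = f-inj (punchOut-injective (y≢f a) (y≢f b) eq)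

injective⇒⤖ : ∀ {n} (f : Fin n → Fin n) → Injective _≡_ _≡_ f → Fin n ⤖ Fin n
injective⇒⤖ f f-inj = mk⤖ (f-inj , surjective)
  where
  surjective : ∀ y → ∃ λ x → ∀ {z} → z ≡ x → f z ≡ y
  surjective y with any? (λ x → f x ≟ y)
  ... | yes (x , fx≡y) = x , λ { refl → fx≡y }
  ... | no ∄x = ⊥-elim (injective-endo-hits f f-inj y (λ x y≡fx → ∄x (x , sym y≡fx)))

record CopyStructure (Γ' Γ : Graph) (N : ℕ) : Set where
  field
    vertexCount        : p Γ * N ≡ p Γ'
    edgeCount          : q Γ * N ≡ q Γ'
    vertexOf           : Fin (p Γ') → Fin (p Γ) × Fin N
    vertexOf-injective : Injective _≡_ _≡_ vertexOf
    edgeOf             : Fin (q Γ') → Fin (q Γ) × Fin N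
    edgeOf-injective   : Injective _≡_ _≡_ edgeOf
    src-over           : ∀ e → proj₁ (vertexOf (src Γ' e)) ≡ src Γ (proj₁ (edgeOf e))
    tgt-over           : ∀ e → proj₁ (vertexOf (tgt Γ' e)) ≡ tgt Γ (proj₁ (edgeOf e))

  edgeCopy srcCopy tgtCopy : Fin (q Γ') → Fin N
  edgeCopy e = proj₂ (edgeOf e)
  srcCopy  e = proj₂ (vertexOf (src Γ' e))
  tgtCopy  e = proj₂ (vertexOf (tgt Γ' e))

copies-loopless : ∀ {Γ' Γ N} → CopyStructure Γ' Γ N → Loopless Γ → Loopless Γ'
copies-loopless 𝒞 loopless e src≡tgt =
  loopless (proj₁ (edgeOf e)) (trans (sym (src-over e)) (trans (cong (λ v → proj₁ (vertexOf v)) src≡tgt) (tgt-over e)))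
  where open CopyStructure 𝒞

module Layered {m m' N : ℕ} (size : m * N ≡ m') (over : Fin m' → Fin m × Fin N)
  (over-injective : Injective _≡_ _≡_ over) (g : Fin m ⤖ Fin m)
  (γ : Fin N → Fin N) (γ-injective : Injective _≡_ _≡_ γ) where

  position : Fin m' → Fin m'
  position v = cast size (combine (Bijection.to g (proj₁ (over v))) (γ (proj₂ (over v))))

  toℕ-position : ∀ v → toℕ (position v) ≡ N * toℕ (Bijection.to g (proj₁ (over v))) + toℕ (γ (proj₂ (over v)))
  toℕ-position v = trans (toℕ-cast size _) (toℕ-combine (Bijection.to g (proj₁ (over v))) (γ (proj₂ (over v))))

  position-injective : Injective _≡_ _≡_ position
  position-injective {v} {v'} eq = over-injective (cong₂ _,_ (Bijection.injective g g-eq) (γ-injective γ-eq))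
    where
    combined-eq = combine-injective _ _ _ _ (toℕ-injective (trans (sym (toℕ-cast size _)) (trans (cong toℕ eq) (toℕ-cast size _))))
    g-eq = proj₁ combined-eq
    γ-eq = proj₂ combined-eq

  relabel : Fin m' ⤖ Fin m'
  relabel = injective⇒⤖ position position-injective

lifted-edge-sum : ∀ N P' p k Fs E Ft as at b → suc Fs + (p + suc E) + suc Ft ≡ k →
  suc (N * Fs + as) + (P' + suc (N * E + b)) + suc (N * Ft + at)
    ≡ 3 + N * (k ∸ (p + 3)) + P' + (as + at + b)
lifted-edge-sum N P' p k Fs E Ft as at b base-magic = begin
  suc (N * Fs + as) + (P' + suc (N * E + b)) + suc (N * Ft + at)
    ≡⟨ solve 8 (λ N P' Fs E Ft as at b →
                  con 1 :+ (N :* Fs :+ as) :+ (P' :+ (con 1 :+ (N :* E :+ b))) :+ (con 1 :+ (N :* Ft :+ at))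
               := con 3 :+ N :* (Fs :+ E :+ Ft) :+ P' :+ (as :+ at :+ b))
             refl N P' Fs E Ft as at b ⟩
  3 + N * (Fs + E + Ft) + P' + (as + at + b)
    ≡⟨ cong (λ x → 3 + N * x + P' + (as + at + b)) base-sum ⟨
  3 + N * (k ∸ (p + 3)) + P' + (as + at + b) ∎
  where
  open ≡-Reasoning
  open +-*-Solver
  base-sum : k ∸ (p + 3) ≡ Fs + E + Ft
  base-sum = begin
    k ∸ (p + 3)
      ≡⟨ cong (_∸ (p + 3)) base-magic ⟨
    suc Fs + (p + suc E) + suc Ft ∸ (p + 3)
      ≡⟨ cong (_∸ (p + 3)) (solve 4 (λ Fs E Ft p → con 1 :+ Fs :+ (p :+ (con 1 :+ E)) :+ (con 1 :+ Ft)
                                                 := (Fs :+ E :+ Ft) :+ (p :+ con 3)) refl Fs E Ft p) ⟩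
    Fs + E + Ft + (p + 3) ∸ (p + 3)
      ≡⟨ m+n∸n≡m (Fs + E + Ft) (p + 3) ⟩
    Fs + E + Ft ∎

lift-SEM : ∀ {Γ' Γ N} (𝒞 : CopyStructure Γ' Γ N) → ∀ {k} → SEM Γ k →
  (α β : Fin N → Fin N) → Injective _≡_ _≡_ α → Injective _≡_ _≡_ β → (C : ℕ) →
  (∀ e → toℕ (α (CopyStructure.srcCopy 𝒞 e)) + toℕ (α (CopyStructure.tgtCopy 𝒞 e))
         + toℕ (β (CopyStructure.edgeCopy 𝒞 e)) ≡ C) →
  SEM Γ' (3 + N * (k ∸ (p Γ + 3)) + p Γ' + C)
lift-SEM {Γ'} {Γ} {N} 𝒞 {k} L α β α-inj β-inj C balanced = record
  { fV = VertexLabels.relabel ; fE = EdgeLabels.relabel ; magic = magic }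
  where
  open CopyStructure 𝒞
  module VertexLabels = Layered vertexCount vertexOf vertexOf-injective (SEM.fV L) α α-inj
  module EdgeLabels   = Layered edgeCount edgeOf edgeOf-injective (SEM.fE L) β β-inj
  F : Fin (p Γ) → ℕ
  F x = toℕ (Bijection.to (SEM.fV L) x)
  end-label : ∀ v x → proj₁ (vertexOf v) ≡ x → toℕ (VertexLabels.position v) ≡ N * F x + toℕ (α (proj₂ (vertexOf v)))
  end-label v x over-x = trans (VertexLabels.toℕ-position v) (cong (λ y → N * F y + _) over-x)
  magic : ∀ e → vlabel VertexLabels.relabel (src Γ' e) + elabel (p Γ') EdgeLabels.relabel e
                + vlabel VertexLabels.relabel (tgt Γ' e) ≡ 3 + N * (k ∸ (p Γ + 3)) + p Γ' + C
  magic e = begin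
    suc (toℕ (VertexLabels.position (src Γ' e))) + (p Γ' + suc (toℕ (EdgeLabels.position e)))
      + suc (toℕ (VertexLabels.position (tgt Γ' e)))
      ≡⟨ cong₂ _+_ (cong₂ (λ a b → suc a + (p Γ' + suc b)) (end-label (src Γ' e) _ (src-over e)) (EdgeLabels.toℕ-position e))
                   (cong suc (end-label (tgt Γ' e) _ (tgt-over e))) ⟩
    suc (N * F (src Γ e₀) + toℕ (α (srcCopy e))) + (p Γ' + suc (N * toℕ (Bijection.to (SEM.fE L) e₀) + toℕ (β (edgeCopy e))))
      + suc (N * F (tgt Γ e₀) + toℕ (α (tgtCopy e)))
      ≡⟨ lifted-edge-sum N (p Γ') (p Γ) k _ _ _ _ _ _ (SEM.magic L e₀) ⟩
    3 + N * (k ∸ (p Γ + 3)) + p Γ' + (toℕ (α (srcCopy e)) + toℕ (α (tgtCopy e)) + toℕ (β (edgeCopy e)))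
      ≡⟨ cong (3 + N * (k ∸ (p Γ + 3)) + p Γ' +_) (balanced e) ⟩
    3 + N * (k ∸ (p Γ + 3)) + p Γ' + C ∎
    where
    open ≡-Reasoning
    e₀ = proj₁ (edgeOf e)

SplitCopies : ∀ {Γ' Γ n} → CopyStructure Γ' Γ (suc n) → Set
SplitCopies 𝒞 = ∀ e → (srcCopy e ≡ fzero × tgtCopy e ≡ edgeCopy e) ⊎ (srcCopy e ≡ edgeCopy e × tgtCopy e ≡ fzero)
  where open CopyStructure 𝒞

module RotatedOffsets {n : ℕ} (r : Fin (suc n)) where

  α β : Fin (suc n) → Fin (suc n)
  α c = transpose fzero r ⟨$⟩ʳ c
  β c = (transpose fzero r ∘ₚ reverse) ⟨$⟩ʳ c

  α-injective : Injective _≡_ _≡_ α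
  α-injective = Bijection.injective (↔⇒⤖ (transpose fzero r))

  β-injective : Injective _≡_ _≡_ β
  β-injective = Bijection.injective (↔⇒⤖ (transpose fzero r ∘ₚ reverse))

  toℕ-β : ∀ c → toℕ (β c) ≡ n ∸ toℕ (α c)
  toℕ-β c = opposite-prop (α c)

  -- a split edge in copy c contributes α(0) + α(c) + (n − α(c)) = r + n
  balanced : ∀ cs ct c → (cs ≡ fzero × ct ≡ c) ⊎ (cs ≡ c × ct ≡ fzero) →
    toℕ (α cs) + toℕ (α ct) + toℕ (β c) ≡ n + toℕ r
  balanced cs ct c split = begin
    toℕ (α cs) + toℕ (α ct) + toℕ (β c)   ≡⟨ cong₂ _+_ (ends-sum split) (toℕ-β c) ⟩
    toℕ r + toℕ (α c) + (n ∸ toℕ (α c))   ≡⟨ +-assoc (toℕ r) _ _ ⟩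
    toℕ r + (toℕ (α c) + (n ∸ toℕ (α c))) ≡⟨ cong (toℕ r +_) (m+[n∸m]≡n (toℕ≤pred[n] (α c))) ⟩
    toℕ r + n                             ≡⟨ +-comm (toℕ r) n ⟩
    n + toℕ r ∎
    where
    open ≡-Reasoning
    ends-sum : (cs ≡ fzero × ct ≡ c) ⊎ (cs ≡ c × ct ≡ fzero) → toℕ (α cs) + toℕ (α ct) ≡ toℕ r + toℕ (α c)
    ends-sum (inj₁ (refl , refl)) = refl
    ends-sum (inj₂ (refl , refl)) = +-comm (toℕ (α c)) (toℕ r)

module S2nCopies (s t q : ℕ) (edge : Fin q → Fin s × Fin t) (inH1 : Fin q → Bool) (n : ℕ) where

  G  = bipartite s t q edge
  Γ' = S2n s t q edge inH1 n

  vertexOf : Fin ((s + t) + (n * s + n * t)) → Fin (s + t) × Fin (suc n)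
  vertexOf v with splitAt (s + t) v
  ... | inj₁ u = u , fzero
  ... | inj₂ w with splitAt (n * s) w
  ...   | inj₁ a = proj₂ (remQuot {n} s a) ↑ˡ t , fsuc (proj₁ (remQuot {n} s a))
  ...   | inj₂ b = s ↑ʳ proj₂ (remQuot {n} t b) , fsuc (proj₁ (remQuot {n} t b))

  vertexAt : Fin (s + t) × Fin (suc n) → Fin ((s + t) + (n * s + n * t))
  vertexAt (u , fzero) = u ↑ˡ (n * s + n * t)
  vertexAt (u , fsuc k) with splitAt s u
  ... | inj₁ i = (s + t) ↑ʳ (combine k i ↑ˡ (n * t))
  ... | inj₂ j = (s + t) ↑ʳ ((n * s) ↑ʳ combine k j)

  vertexAt-vertexOf : ∀ v → vertexAt (vertexOf v) ≡ v
  vertexAt-vertexOf v with splitAt (s + t) v in split₁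
  ... | inj₁ u = splitAt⁻¹-↑ˡ split₁
  ... | inj₂ w with splitAt (n * s) w in split₂
  ...   | inj₁ a rewrite splitAt-↑ˡ s (proj₂ (remQuot {n} s a)) t =
          trans (cong (λ z → (s + t) ↑ʳ (z ↑ˡ (n * t))) (combine-remQuot {n} s a))
                (trans (cong ((s + t) ↑ʳ_) (splitAt⁻¹-↑ˡ split₂)) (splitAt⁻¹-↑ʳ split₁))
  ...   | inj₂ b rewrite splitAt-↑ʳ s t (proj₂ (remQuot {n} t b)) =
          trans (cong (λ z → (s + t) ↑ʳ ((n * s) ↑ʳ z)) (combine-remQuot {n} t b))
                (trans (cong ((s + t) ↑ʳ_) (splitAt⁻¹-↑ʳ split₂)) (splitAt⁻¹-↑ʳ split₁))

  edgeOf : Fin (q + n * q) → Fin q × Fin (suc n)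
  edgeOf e with splitAt q e
  ... | inj₁ e₀ = e₀ , fzero
  ... | inj₂ ke = proj₂ (remQuot {n} q ke) , fsuc (proj₁ (remQuot {n} q ke))

  edgeAt : Fin q × Fin (suc n) → Fin (q + n * q)
  edgeAt (e₀ , fzero)  = e₀ ↑ˡ (n * q)
  edgeAt (e₀ , fsuc k) = q ↑ʳ combine k e₀

  edgeAt-edgeOf : ∀ e → edgeAt (edgeOf e) ≡ e
  edgeAt-edgeOf e with splitAt q e in split
  ... | inj₁ e₀ = splitAt⁻¹-↑ˡ split
  ... | inj₂ ke = trans (cong (q ↑ʳ_) (combine-remQuot {n} q ke)) (splitAt⁻¹-↑ʳ split)

  vertexOf-X : ∀ i → vertexOf ((i ↑ˡ t) ↑ˡ (n * s + n * t)) ≡ (i ↑ˡ t , fzero)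
  vertexOf-X i rewrite splitAt-↑ˡ (s + t) (i ↑ˡ t) (n * s + n * t) = refl

  vertexOf-Y : ∀ j → vertexOf ((s ↑ʳ j) ↑ˡ (n * s + n * t)) ≡ (s ↑ʳ j , fzero)
  vertexOf-Y j rewrite splitAt-↑ˡ (s + t) (s ↑ʳ j) (n * s + n * t) = refl

  vertexOf-Xₖ : ∀ k i → vertexOf ((s + t) ↑ʳ (combine k i ↑ˡ (n * t))) ≡ (i ↑ˡ t , fsuc k)
  vertexOf-Xₖ k i rewrite splitAt-↑ʳ (s + t) (n * s + n * t) (combine k i ↑ˡ (n * t))
    | splitAt-↑ˡ (n * s) (combine k i) (n * t) =
    cong (λ (k' , i') → i' ↑ˡ t , fsuc k') (remQuot-combine k i)

  vertexOf-Yₖ : ∀ k j → vertexOf ((s + t) ↑ʳ ((n * s) ↑ʳ combine k j)) ≡ (s ↑ʳ j , fsuc k)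
  vertexOf-Yₖ k j rewrite splitAt-↑ʳ (s + t) (n * s + n * t) ((n * s) ↑ʳ combine k j)
    | splitAt-↑ʳ (n * s) (n * t) (combine k j) =
    cong (λ (k' , j') → s ↑ʳ j' , fsuc k') (remQuot-combine k j)

  ends-over : ∀ e →
      (vertexOf (src Γ' e) ≡ (src G (proj₁ (edgeOf e)) , fzero) × vertexOf (tgt Γ' e) ≡ (tgt G (proj₁ (edgeOf e)) , proj₂ (edgeOf e)))
    ⊎ (vertexOf (src Γ' e) ≡ (src G (proj₁ (edgeOf e)) , proj₂ (edgeOf e)) × vertexOf (tgt Γ' e) ≡ (tgt G (proj₁ (edgeOf e)) , fzero))
  -- (remQuot unfolds to quotRem, so the case split is on the latter)
  ends-over e with splitAt q e
  ... | inj₁ e₀ = inj₁ (vertexOf-X _ , vertexOf-Y _)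
  ... | inj₂ ke with quotRem {n} q ke
  ...   | e₀ , k with inH1 e₀
  ...     | true  = inj₁ (vertexOf-X _ , vertexOf-Yₖ k _)
  ...     | false = inj₂ (vertexOf-Xₖ k _ , vertexOf-Y _)

  copies : CopyStructure Γ' G (suc n)
  copies = record
    { vertexCount        = trans (*-suc (s + t) n) (cong ((s + t) +_) (trans (*-comm (s + t) n) (*-distribˡ-+ n s t)))
    ; edgeCount          = trans (*-suc q n) (cong (q +_) (*-comm q n))
    ; vertexOf           = vertexOf
    ; vertexOf-injective = inverseʳ⇒injective vertexOf (strictlyInverseʳ⇒inverseʳ {f⁻¹ = vertexAt} vertexOf vertexAt-vertexOf)
    ; edgeOf             = edgeOf
    ; edgeOf-injective   = inverseʳ⇒injective edgeOf (strictlyInverseʳ⇒inverseʳ {f⁻¹ = edgeAt} edgeOf edgeAt-edgeOf)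
    ; src-over           = λ e → [ (λ ends → cong proj₁ (proj₁ ends)) , (λ ends → cong proj₁ (proj₁ ends)) ]′ (ends-over e)
    ; tgt-over           = λ e → [ (λ ends → cong proj₁ (proj₂ ends)) , (λ ends → cong proj₁ (proj₂ ends)) ]′ (ends-over e)
    }

  split : SplitCopies copies
  split e with ends-over e
  ... | inj₁ (src≡ , tgt≡) = inj₁ (cong proj₂ src≡ , cong proj₂ tgt≡)
  ... | inj₂ (src≡ , tgt≡) = inj₂ (cong proj₂ src≡ , cong proj₂ tgt≡)

module ShiftedValences (s t q : ℕ) (edge : Fin q → Fin s × Fin t) (inH1 : Fin q → Bool)
  {K : ℕ} (L : SEM (bipartite s t q edge) K) (n : ℕ) where

  open S2nCopies s t q edge inH1 n using (Γ'; copies; split)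

  valence : Fin (suc n) → ℕ
  valence r = 3 + suc n * (K ∸ (s + t + 3)) + p Γ' + (n + toℕ r)

  valence-injective : Injective _≡_ _≡_ valence
  valence-injective eq = toℕ-injective (+-cancelˡ-≡ n _ _ (+-cancelˡ-≡ (3 + suc n * (K ∸ (s + t + 3)) + p Γ') _ _ eq))

  valence-in-σ : ∀ r → Inσ Γ' (valence r)
  valence-in-σ r = SEM⇒Inσ Γ' (copies-loopless copies (bipartite-loopless s t q edge))
    (lift-SEM copies L α β α-injective β-injective (n + toℕ r)
      (λ e → balanced _ _ _ (split e)))
    where open RotatedOffsets r

-- For n ≥ M the first M shifts give M distinct elements of σ_{S_{2n}}.
corollary3p7 : (s t q : ℕ) (edge : Fin q → Fin s × Fin t) → Injective _≡_ _≡_ edge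
    → (inH1 : Fin q → Bool)
    → SuperEdgeMagic (bipartite s t q edge)
    → ∀ M → ∃ λ N → ∀ n → N ≤ n → CardGE M (Inσ (S2n s t q edge inH1 n))
corollary3p7 s t q edge _ inH1 (K , L) M = M , λ n M≤n →
  let open ShiftedValences s t q edge inH1 L n
      shift : Fin M → Fin (suc n)
      shift i = inject≤ i (m≤n⇒m≤1+n M≤n)
  in  (λ i → valence (shift i))
    , (λ eq → inject≤-injective _ _ _ _ (valence-injective eq))
    , (λ i → valence-in-σ (shift i))
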